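{- Let $k\ge 0$ and $n\ge 0$ be integers and $\nu=\lfloor n/2\rfloor$. The number $m_k^{(n)}$ of $k$-Motzkin paths of length $n$ is $$m_k^{(n)}=\sum_{j=0}^{\nu}\sum_{i=0}^{\infty}p^{2j}_{k,i}\binom{n-2j+i-1}{n-2j},$$ where $p^{2j}_{k,i}$ is the number of Dyck paths of length $2j$ that are $i$-ped at level $k$, and the binomial coefficient $\binom{ -1}{0}$ (arising when $i=0$, $n=2j$) is taken to be $1$.
   Context: A Motzkin path of length $n$ is a lattice path with $n$ steps from $(0,0)$ to $(n,0)$ using steps $(1,1)$, $(1,0)$, $(1,-1)$ that never goes below the $x$-axis. A Dyck path is a Motzkin path with no $(1,0)$ steps. A $k$-Motzkin path is a Motzkin path all of whose horizontal steps $(1,0)$ lie at height $k$. A Dyck path of length $2j$ has $2j+1$ vertices (including both endpoints); it is $i$-ped at level $k$ if exactly $i$ of its vertices have $y$-coordinate $k$. For integers $a\ge0$, $\binom{a+i-1}{a}$ with $i\ge1$ is the usual binomial coefficient and equals $0$ if $i=0$, $a>0$. -}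

module Defs where

open import Data.Nat using (ℕ; zero; suc; _+_; _∸_; _*_; _≡ᵇ_)
open import Data.Nat.Combinatorics using (_C_)
open import Data.Bool using (Bool; true; false; _∧_; if_then_else_)
open import Data.List using (List; []; _∷_; map; concatMap; filterᵇ; length; upTo)
open import Data.Nat.ListAction using (sum)

-- Steps: U = (1,1), H = (1,0), D = (1,-1)
data Step : Set where
  U H D : Step

words : ℕ → List (List Step)
words zero = [] ∷ []
words (suc n) = concatMap (λ w → (U ∷ w) ∷ (H ∷ w) ∷ (D ∷ w) ∷ []) (words n)

isMotzkinFrom : ℕ → List Step → Bool
isMotzkinFrom h [] = h ≡ᵇ 0
isMotzkinFrom h (U ∷ s) = isMotzkinFrom (suc h) s
isMotzkinFrom h (H ∷ s) = isMotzkinFrom h s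
isMotzkinFrom zero (D ∷ s) = false
isMotzkinFrom (suc h) (D ∷ s) = isMotzkinFrom h s

isMotzkin : List Step → Bool
isMotzkin = isMotzkinFrom 0

horizAtFrom : ℕ → ℕ → List Step → Bool
horizAtFrom k h [] = true
horizAtFrom k h (U ∷ s) = horizAtFrom k (suc h) s
horizAtFrom k h (H ∷ s) = (h ≡ᵇ k) ∧ horizAtFrom k h s
horizAtFrom k h (D ∷ s) = horizAtFrom k (h ∸ 1) s

isKMotzkin : ℕ → List Step → Bool
isKMotzkin k s = isMotzkin s ∧ horizAtFrom k 0 s

noHoriz : List Step → Bool
noHoriz [] = true
noHoriz (H ∷ s) = false
noHoriz (U ∷ s) = noHoriz s
noHoriz (D ∷ s) = noHoriz s

isDyck : List Step → Bool
isDyck s = isMotzkin s ∧ noHoriz s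

heightsFrom : ℕ → List Step → List ℕ
heightsFrom h [] = h ∷ []
heightsFrom h (U ∷ s) = h ∷ heightsFrom (suc h) s
heightsFrom h (H ∷ s) = h ∷ heightsFrom h s
heightsFrom h (D ∷ s) = h ∷ heightsFrom (h ∸ 1) s

verticesAt : ℕ → List Step → ℕ
verticesAt k s = length (filterᵇ (λ y → y ≡ᵇ k) (heightsFrom 0 s))

isIPed : ℕ → ℕ → List Step → Bool
isIPed k i s = verticesAt k s ≡ᵇ i

motzkinK : ℕ → ℕ → ℕ
motzkinK k n = length (filterᵇ (isKMotzkin k) (words n))

pDyck : ℕ → ℕ → ℕ → ℕ
pDyck len k i = length (filterᵇ (λ s → isDyck s ∧ isIPed k i s) (words len))

-- binom(a+i-1, a) with the paper's conventions: for i ≥ 1 the usual value,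
-- for i = 0: 0 if a > 0 and binom(-1,0) = 1 if a = 0
binomShift : ℕ → ℕ → ℕ
binomShift zero zero = 1
binomShift (suc a) zero = 0
binomShift a (suc i) = (a + i) C a

sumTo : ℕ → (ℕ → ℕ) → ℕ
sumTo m f = sum (map f (upTo m))

module Submission where

-- Fix the level k.  For a start height h let K h n count the
-- step words of length n that are Motzkin paths from height h whose horizontal
-- steps all lie at height k.  Deleting the horizontal steps of such a path
-- leaves a Dyck path d from h; conversely a horizontal steps can be re-inserted
-- at the c vertices of d at height k in multichoose(c, a) = binomShift a c ways.
-- Rather than formalising this bijection we compare recursions: R h n denotes
-- the weighted count Σ_ℓ Σ_d multichoose(level d, n - ℓ) over Dyck paths d of
-- length ℓ from h, and we show that K and R satisfy the same first-step
-- recursion in n (for all h at once), so K = R.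

open import Defs
open import Data.Nat using (ℕ; zero; suc; _+_; _*_; _∸_; _≡ᵇ_; _≤_; _<_; z≤n; s≤s; _/_; _%_; parity)
open import Data.Nat.Properties
  using (+-identityʳ; +-assoc; +-comm; +-suc; *-suc; *-comm; *-identityʳ; *-zeroʳ; *-distribʳ-+;
         +-∸-assoc; n∸n≡0; ≤-trans; ≤-reflexive; +-monoʳ-≤; *-monoʳ-≤; +-commutativeSemigroup)
open import Data.Nat.Combinatorics using (_C_; nCn≡1; nCk+nC[k+1]≡[n+1]C[k+1])
open import Data.Nat.DivMod using (m≡m%n+[m/n]*n; m%n<n; m/n*n≤m)
open import Data.Nat.ListAction using (sum)
open import Data.Parity.Base using (1ℙ) renaming (_+_ to _+ℙ_)
open import Data.Parity.Properties using (+-homo-+; *-homo-*)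
open import Data.Bool using (Bool; true; false; _∧_; if_then_else_; T?)
open import Data.Bool.Properties using (∧-zeroʳ; ∧-identityʳ)
open import Data.List using (List; []; _∷_; _++_; map; concatMap; filterᵇ; length; applyUpTo)
open import Data.List.Properties using (length-filter)
open import Data.List.Relation.Unary.All using (All; []; _∷_)
import Data.List.Relation.Unary.All as All
open import Data.List.Relation.Unary.All.Properties using (concat⁺; map⁺)
open import Function using (_∘_; id)
open import Relation.Binary.PropositionalEquality using (_≡_; refl; sym; trans; cong; cong₂; module ≡-Reasoning)
open import Algebra.Properties.CommutativeSemigroup +-commutativeSemigroup
  using (x∙yz≈y∙xz; xy∙z≈xz∙y; interchange)

open ≡-Reasoning

[_] : Bool → ℕ
[ b ] = if b then 1 else 0

∑ : ℕ → (ℕ → ℕ) → ℕ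
∑ zero f = 0
∑ (suc m) f = f 0 + ∑ m (f ∘ suc)

sumTo≡∑ : ∀ m f → sumTo m f ≡ ∑ m f
sumTo≡∑ m f = shifted m id
  where
  shifted : ∀ m (s : ℕ → ℕ) → sum (map f (applyUpTo s m)) ≡ ∑ m (f ∘ s)
  shifted zero s = refl
  shifted (suc m) s = cong (f (s 0) +_) (shifted m (s ∘ suc))

∑-cong : ∀ m {f g : ℕ → ℕ} → (∀ i → i < m → f i ≡ g i) → ∑ m f ≡ ∑ m g
∑-cong zero eq = refl
∑-cong (suc m) eq = cong₂ _+_ (eq 0 (s≤s z≤n)) (∑-cong m (λ i i<m → eq (suc i) (s≤s i<m)))

sumTo²≡∑ : ∀ m M (F : ℕ → ℕ → ℕ) → sumTo (m + 1) (λ j → sumTo M (F j)) ≡ ∑ (suc m) (λ j → ∑ M (F j))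
sumTo²≡∑ m M F = begin
    sumTo (m + 1) (λ j → sumTo M (F j))  ≡⟨ sumTo≡∑ (m + 1) (λ j → sumTo M (F j)) ⟩
    ∑ (m + 1) (λ j → sumTo M (F j))      ≡⟨ cong (λ m′ → ∑ m′ (λ j → sumTo M (F j))) (+-comm m 1) ⟩
    ∑ (suc m) (λ j → sumTo M (F j))      ≡⟨ ∑-cong (suc m) (λ j _ → sumTo≡∑ M (F j)) ⟩
    ∑ (suc m) (λ j → ∑ M (F j))          ∎

∑-zero : ∀ m {f : ℕ → ℕ} → (∀ i → f i ≡ 0) → ∑ m f ≡ 0
∑-zero zero f≡0 = refl
∑-zero (suc m) f≡0 = cong₂ _+_ (f≡0 0) (∑-zero m (f≡0 ∘ suc))

∑-+ : ∀ m (f g : ℕ → ℕ) → ∑ m (λ i → f i + g i) ≡ ∑ m f + ∑ m g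
∑-+ zero f g = refl
∑-+ (suc m) f g =
  trans (cong (f 0 + g 0 +_) (∑-+ m (f ∘ suc) (g ∘ suc)))
        (interchange (f 0) (g 0) (∑ m (f ∘ suc)) (∑ m (g ∘ suc)))

∑-snoc : ∀ m (f : ℕ → ℕ) → ∑ (suc m) f ≡ ∑ m f + f m
∑-snoc zero f = +-comm (f 0) 0
∑-snoc (suc m) f = trans (cong (f 0 +_) (∑-snoc m (f ∘ suc))) (sym (+-assoc (f 0) _ _))

∑-select : ∀ N c (b : ℕ → ℕ) → c < N → ∑ N (λ i → [ c ≡ᵇ i ] * b i) ≡ b c
∑-select (suc N) zero b _ = trans (cong₂ _+_ (+-identityʳ (b 0)) (∑-zero N (λ _ → refl))) (+-identityʳ _)
∑-select (suc N) (suc c) b (s≤s c<N) = ∑-select N c (b ∘ suc) c<N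

∑ₗ : {A : Set} → (A → ℕ) → List A → ℕ
∑ₗ f [] = 0
∑ₗ f (x ∷ xs) = f x + ∑ₗ f xs

module _ {A : Set} where

  ∑ₗ-cong : {f g : A → ℕ} → (∀ x → f x ≡ g x) → ∀ xs → ∑ₗ f xs ≡ ∑ₗ g xs
  ∑ₗ-cong eq [] = refl
  ∑ₗ-cong eq (x ∷ xs) = cong₂ _+_ (eq x) (∑ₗ-cong eq xs)

  ∑ₗ-zero : {f : A → ℕ} → (∀ x → f x ≡ 0) → ∀ xs → ∑ₗ f xs ≡ 0
  ∑ₗ-zero f≡0 [] = refl
  ∑ₗ-zero f≡0 (x ∷ xs) = cong₂ _+_ (f≡0 x) (∑ₗ-zero f≡0 xs)

  ∑ₗ-+ : ∀ (f g : A → ℕ) xs → ∑ₗ (λ x → f x + g x) xs ≡ ∑ₗ f xs + ∑ₗ g xs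
  ∑ₗ-+ f g [] = refl
  ∑ₗ-+ f g (x ∷ xs) =
    trans (cong (f x + g x +_) (∑ₗ-+ f g xs)) (interchange (f x) (g x) (∑ₗ f xs) (∑ₗ g xs))

  ∑ₗ-++ : ∀ (f : A → ℕ) xs ys → ∑ₗ f (xs ++ ys) ≡ ∑ₗ f xs + ∑ₗ f ys
  ∑ₗ-++ f [] ys = refl
  ∑ₗ-++ f (x ∷ xs) ys = trans (cong (f x +_) (∑ₗ-++ f xs ys)) (sym (+-assoc (f x) _ _))

  ∑ₗ-concatMap : ∀ {B : Set} (f : A → ℕ) (g : B → List A) xs →
                 ∑ₗ f (concatMap g xs) ≡ ∑ₗ (λ y → ∑ₗ f (g y)) xs
  ∑ₗ-concatMap f g [] = refl
  ∑ₗ-concatMap f g (y ∷ ys) = trans (∑ₗ-++ f (g y) _) (cong (∑ₗ f (g y) +_) (∑ₗ-concatMap f g ys))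

  length-filterᵇ-∷ : ∀ (p : A → Bool) x xs → length (filterᵇ p (x ∷ xs)) ≡ [ p x ] + length (filterᵇ p xs)
  length-filterᵇ-∷ p x xs with p x
  ... | true = refl
  ... | false = refl

  length-filterᵇ≡∑ₗ : ∀ (p : A → Bool) xs → length (filterᵇ p xs) ≡ ∑ₗ ([_] ∘ p) xs
  length-filterᵇ≡∑ₗ p [] = refl
  length-filterᵇ≡∑ₗ p (x ∷ xs) = trans (length-filterᵇ-∷ p x xs) (cong ([ p x ] +_) (length-filterᵇ≡∑ₗ p xs))

  ∑-fibres : ∀ N (P : A → Bool) (g : A → ℕ) (b : ℕ → ℕ) xs → All (λ x → g x < N) xs →
             ∑ N (λ i → length (filterᵇ (λ x → P x ∧ (g x ≡ᵇ i)) xs) * b i)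
               ≡ ∑ₗ (λ x → if P x then b (g x) else 0) xs
  ∑-fibres N P g b [] [] = ∑-zero N (λ _ → refl)
  ∑-fibres N P g b (x ∷ xs) (gx<N ∷ bounded) = begin
      ∑ N (λ i → length (filterᵇ (fibre i) (x ∷ xs)) * b i)
        ≡⟨ ∑-cong N (λ i _ → trans (cong (_* b i) (length-filterᵇ-∷ (fibre i) x xs))
                                   (*-distribʳ-+ (b i) [ fibre i x ] _)) ⟩
      ∑ N (λ i → [ fibre i x ] * b i + length (filterᵇ (fibre i) xs) * b i)
        ≡⟨ ∑-+ N (λ i → [ fibre i x ] * b i) _ ⟩
      ∑ N (λ i → [ fibre i x ] * b i) + ∑ N (λ i → length (filterᵇ (fibre i) xs) * b i)
        ≡⟨ cong₂ _+_ (head (P x)) (∑-fibres N P g b xs bounded) ⟩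
      (if P x then b (g x) else 0) + ∑ₗ (λ x → if P x then b (g x) else 0) xs ∎
    where
    fibre : ℕ → A → Bool
    fibre i x = P x ∧ (g x ≡ᵇ i)
    head : ∀ c → ∑ N (λ i → [ c ∧ (g x ≡ᵇ i) ] * b i) ≡ (if c then b (g x) else 0)
    head true = ∑-select N (g x) b gx<N
    head false = ∑-zero N (λ _ → refl)

-- binomShift a c = C(a + c - 1, a) is the number of multisets of size a drawn
-- from c elements, i.e. of ways to put a horizontal steps at c vertices.

multichoose-suc : ∀ a c → binomShift a (suc c) ≡ (a + c) C a
multichoose-suc zero c = refl
multichoose-suc (suc a) c = refl

multichoose-zero : ∀ c → binomShift 0 c ≡ 1
multichoose-zero zero = refl
multichoose-zero (suc c) = refl

multichoose-one : ∀ a → binomShift a 1 ≡ 1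
multichoose-one zero = refl
multichoose-one (suc a) = trans (cong (_C suc a) (+-identityʳ (suc a))) (nCn≡1 (suc a))

-- Pascal's rule for multisets: either the new element is used or it is not.
multichoose-pascal : ∀ a c → binomShift (suc a) (suc c) ≡ binomShift (suc a) c + binomShift a (suc c)
multichoose-pascal a zero = trans (multichoose-one (suc a)) (sym (multichoose-one a))
multichoose-pascal a (suc c) = begin
    suc (a + suc c) C suc a                ≡⟨ sym (nCk+nC[k+1]≡[n+1]C[k+1] (a + suc c) a) ⟩
    (a + suc c) C a + (a + suc c) C suc a  ≡⟨ +-comm ((a + suc c) C a) _ ⟩
    (a + suc c) C suc a + (a + suc c) C a  ≡⟨ cong (λ m → m C suc a + (a + suc c) C a) (+-suc a c) ⟩
    (suc a + c) C suc a + (a + suc c) C a  ≡⟨ cong ((suc a + c) C suc a +_) (sym (multichoose-suc a (suc c))) ⟩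
    binomShift (suc a) (suc c) + binomShift a (suc (suc c)) ∎

-- below f h is the contribution f (h - 1) of a down step from height h (none at h = 0).
below : (ℕ → ℕ) → ℕ → ℕ
below f zero = 0
below f (suc h) = f h

below-cong : {f g : ℕ → ℕ} → (∀ h → f h ≡ g h) → ∀ h → below f h ≡ below g h
below-cong eq zero = refl
below-cong eq (suc h) = eq h

∑-below : ∀ m (f : ℕ → ℕ → ℕ) h → ∑ m (λ i → below (f i) h) ≡ below (λ h′ → ∑ m (λ i → f i h′)) h
∑-below m f zero = ∑-zero m (λ _ → refl)
∑-below m f (suc h) = refl

∑ₗ-words : ∀ (f : List Step → ℕ) n →
  ∑ₗ f (words (suc n)) ≡ ∑ₗ (f ∘ (U ∷_)) (words n) + (∑ₗ (f ∘ (H ∷_)) (words n) + ∑ₗ (f ∘ (D ∷_)) (words n))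
∑ₗ-words f n = begin
    ∑ₗ f (words (suc n))
      ≡⟨ ∑ₗ-concatMap f (λ w → (U ∷ w) ∷ (H ∷ w) ∷ (D ∷ w) ∷ []) (words n) ⟩
    ∑ₗ (λ w → f (U ∷ w) + (f (H ∷ w) + (f (D ∷ w) + 0))) (words n)
      ≡⟨ ∑ₗ-cong (λ w → cong (λ x → f (U ∷ w) + (f (H ∷ w) + x)) (+-identityʳ _)) (words n) ⟩
    ∑ₗ (λ w → f (U ∷ w) + (f (H ∷ w) + f (D ∷ w))) (words n)
      ≡⟨ ∑ₗ-+ (f ∘ (U ∷_)) _ (words n) ⟩
    ∑ₗ (f ∘ (U ∷_)) (words n) + ∑ₗ (λ w → f (H ∷ w) + f (D ∷ w)) (words n)
      ≡⟨ cong (∑ₗ (f ∘ (U ∷_)) (words n) +_) (∑ₗ-+ (f ∘ (H ∷_)) (f ∘ (D ∷_)) (words n)) ⟩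
    ∑ₗ (f ∘ (U ∷_)) (words n) + (∑ₗ (f ∘ (H ∷_)) (words n) + ∑ₗ (f ∘ (D ∷_)) (words n)) ∎

words-length : ∀ ℓ → All (λ w → length w ≡ ℓ) (words ℓ)
words-length zero = refl ∷ []
words-length (suc ℓ) =
  concat⁺ (map⁺ (All.map (λ eq → cong suc eq ∷ cong suc eq ∷ cong suc eq ∷ []) (words-length ℓ)))

length-heightsFrom : ∀ h d → length (heightsFrom h d) ≡ suc (length d)
length-heightsFrom h [] = refl
length-heightsFrom h (U ∷ d) = cong suc (length-heightsFrom (suc h) d)
length-heightsFrom h (H ∷ d) = cong suc (length-heightsFrom h d)
length-heightsFrom h (D ∷ d) = cong suc (length-heightsFrom (h ∸ 1) d)

-- A path of length ℓ has ℓ + 1 vertices, so at most ℓ + 1 of them at level k.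
verticesAt-bound : ∀ k d → verticesAt k d ≤ suc (length d)
verticesAt-bound k d =
  ≤-trans (length-filter (T? ∘ (_≡ᵇ k)) (heightsFrom 0 d)) (≤-reflexive (length-heightsFrom 0 d))

parity-odd : ∀ m → parity (suc (2 * m)) ≡ 1ℙ
parity-odd m = trans (+-homo-+ 1 (2 * m)) (cong (1ℙ +ℙ_) (*-homo-* 2 m))

∑-evens : ∀ (g : ℕ → ℕ) → (∀ m → g (suc (2 * m)) ≡ 0) →
          ∀ n → ∑ (suc n) g ≡ ∑ (suc (n / 2)) (λ j → g (2 * j))
∑-evens g odd≡0 n = begin
    ∑ (suc n) g                        ≡⟨ cong (λ m → ∑ (suc m) g) (m≡m%n+[m/n]*n n 2) ⟩
    ∑ (suc (n % 2 + n / 2 * 2)) g      ≡⟨ by-remainder (n % 2) (n / 2) (m%n<n n 2) ⟩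
    ∑ (suc (n / 2)) (λ j → g (2 * j))  ∎
  where
  drop-odd : ∀ q → ∑ (suc (suc (2 * q))) g ≡ ∑ (suc (2 * q)) g
  drop-odd q = trans (∑-snoc (suc (2 * q)) g) (trans (cong (∑ (suc (2 * q)) g +_) (odd≡0 q)) (+-identityʳ _))
  evens : ∀ q → ∑ (suc (2 * q)) g ≡ ∑ (suc q) (λ j → g (2 * j))
  evens zero = refl
  evens (suc q) = begin
      ∑ (suc (2 * suc q)) g                            ≡⟨ cong (λ m → ∑ (suc m) g) (*-suc 2 q) ⟩
      ∑ (suc (suc (suc (2 * q)))) g                    ≡⟨ ∑-snoc (suc (suc (2 * q))) g ⟩
      ∑ (suc (suc (2 * q))) g + g (suc (suc (2 * q)))  ≡⟨ cong₂ _+_ (trans (drop-odd q) (evens q))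
                                                                  (cong g (sym (*-suc 2 q))) ⟩
      ∑ (suc q) (λ j → g (2 * j)) + g (2 * suc q)      ≡⟨ sym (∑-snoc (suc q) (λ j → g (2 * j))) ⟩
      ∑ (suc (suc q)) (λ j → g (2 * j))                ∎
  by-remainder : ∀ r q → r < 2 → ∑ (suc (r + q * 2)) g ≡ ∑ (suc q) (λ j → g (2 * j))
  by-remainder 0 q _ = trans (cong (λ m → ∑ (suc m) g) (*-comm q 2)) (evens q)
  by-remainder 1 q _ = trans (cong (λ m → ∑ (suc (suc m)) g) (*-comm q 2)) (trans (drop-odd q) (evens q))
  by-remainder (suc (suc r)) q (s≤s (s≤s ()))

module Level (k : ℕ) where

  level : ℕ → List Step → ℕ
  level h d = length (filterᵇ (λ y → y ≡ᵇ k) (heightsFrom h d))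

  level-∷ : ∀ e h ys → e + length (filterᵇ (λ y → y ≡ᵇ k) (h ∷ ys))
                         ≡ (e + [ h ≡ᵇ k ]) + length (filterᵇ (λ y → y ≡ᵇ k) ys)
  level-∷ e h ys = trans (cong (e +_) (length-filterᵇ-∷ (λ y → y ≡ᵇ k) h ys)) (sym (+-assoc e _ _))

  K : ℕ → ℕ → ℕ
  K h n = ∑ₗ (λ w → [ isMotzkinFrom h w ∧ horizAtFrom k h w ]) (words n)

  K-base : ∀ h → K h 0 ≡ [ h ≡ᵇ 0 ]
  K-base h = trans (+-identityʳ _) (cong [_] (∧-identityʳ (h ≡ᵇ 0)))

  K-rec : ∀ h n → K h (suc n) ≡ K (suc h) n + ((if h ≡ᵇ k then K h n else 0) + below (λ h′ → K h′ n) h)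
  K-rec h n = trans (∑ₗ-words _ n) (cong (K (suc h) n +_) (cong₂ _+_ (flat (h ≡ᵇ k)) (down h)))
    where
    flat : ∀ c → ∑ₗ (λ w → [ isMotzkinFrom h w ∧ (c ∧ horizAtFrom k h w) ]) (words n) ≡ (if c then K h n else 0)
    flat true = refl
    flat false = ∑ₗ-zero (λ w → cong [_] (∧-zeroʳ (isMotzkinFrom h w))) (words n)
    down : ∀ h → ∑ₗ (λ w → [ isMotzkinFrom h (D ∷ w) ∧ horizAtFrom k h (D ∷ w) ]) (words n) ≡ below (λ h′ → K h′ n) h
    down zero = ∑ₗ-zero (λ _ → refl) (words n)
    down (suc h) = refl

  isDyckFrom : ℕ → List Step → Bool
  isDyckFrom h d = isMotzkinFrom h d ∧ noHoriz d

  -- A Dyck path d from h, with e further vertices at level k available, admits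
  -- multichoose(e + level h d, a) ways of inserting a horizontal steps at level k.
  weight : ℕ → ℕ → ℕ → List Step → ℕ
  weight e h a d = if isDyckFrom h d then binomShift a (e + level h d) else 0

  W : ℕ → ℕ → ℕ → ℕ → ℕ
  W e h a ℓ = ∑ₗ (weight e h a) (words ℓ)

  -- the empty path is a Dyck path only from height 0, and has one vertex at height h
  W-empty : ∀ e h a → W e h a 0 ≡ [ h ≡ᵇ 0 ] * binomShift a (e + [ h ≡ᵇ k ])
  W-empty e h a with h ≡ᵇ 0
  ... | false = refl
  ... | true = cong (λ c → binomShift a c + 0) (trans (level-∷ e h []) (+-identityʳ _))

  -- First-step recursion for Dyck paths: the first vertex contributes [h = k] to e.
  W-rec : ∀ e h a ℓ → W e h a (suc ℓ) ≡ W (e + [ h ≡ᵇ k ]) (suc h) a ℓ + below (λ h′ → W (e + [ h ≡ᵇ k ]) h′ a ℓ) h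
  W-rec e h a ℓ = trans (∑ₗ-words (weight e h a) ℓ) (cong₂ _+_ up (cong₂ _+_ flat (down h)))
    where
    shift : ∀ h h′ d → (if isDyckFrom h′ d then binomShift a (e + length (filterᵇ (λ y → y ≡ᵇ k) (h ∷ heightsFrom h′ d))) else 0)
                     ≡ weight (e + [ h ≡ᵇ k ]) h′ a d
    shift h h′ d = cong (λ c → if isDyckFrom h′ d then binomShift a c else 0) (level-∷ e h (heightsFrom h′ d))
    up : ∑ₗ (weight e h a ∘ (U ∷_)) (words ℓ) ≡ W (e + [ h ≡ᵇ k ]) (suc h) a ℓ
    up = ∑ₗ-cong (shift h (suc h)) (words ℓ)
    flat : ∑ₗ (weight e h a ∘ (H ∷_)) (words ℓ) ≡ 0
    flat = ∑ₗ-zero (λ d → cong (λ b → if b then binomShift a (e + level h (H ∷ d)) else 0) (∧-zeroʳ (isMotzkinFrom h d))) (words ℓ)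
    down : ∀ h → ∑ₗ (weight e h a ∘ (D ∷_)) (words ℓ) ≡ below (λ h′ → W (e + [ h ≡ᵇ k ]) h′ a ℓ) h
    down zero = ∑ₗ-zero (λ _ → refl) (words ℓ)
    down (suc h′) = ∑ₗ-cong (shift (suc h′) h′) (words ℓ)

  W-pascal : ∀ e h a ℓ → W (suc e) h (suc a) ℓ ≡ W e h (suc a) ℓ + W (suc e) h a ℓ
  W-pascal e h a ℓ = trans (∑ₗ-cong pointwise (words ℓ)) (∑ₗ-+ (weight e h (suc a)) (weight (suc e) h a) (words ℓ))
    where
    pointwise : ∀ d → weight (suc e) h (suc a) d ≡ weight e h (suc a) d + weight (suc e) h a d
    pointwise d with isDyckFrom h d
    ... | true = multichoose-pascal a (e + level h d)
    ... | false = refl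

  W-insert-none : ∀ e h ℓ → W (suc e) h 0 ℓ ≡ W e h 0 ℓ
  W-insert-none e h ℓ = ∑ₗ-cong pointwise (words ℓ)
    where
    pointwise : ∀ d → weight (suc e) h 0 d ≡ weight e h 0 d
    pointwise d with isDyckFrom h d
    ... | true = trans (multichoose-zero (suc e + level h d)) (sym (multichoose-zero (e + level h d)))
    ... | false = refl

  S : ℕ → ℕ → ℕ → ℕ
  S e h n = ∑ (suc n) (λ ℓ → W e h (n ∸ ℓ) ℓ)

  S-step : ∀ e h n → S e h (suc n) ≡ W e h (suc n) 0 + (S (e + [ h ≡ᵇ k ]) (suc h) n + below (λ h′ → S (e + [ h ≡ᵇ k ]) h′ n) h)
  S-step e h n = cong (W e h (suc n) 0 +_) (begin
      ∑ (suc n) (λ ℓ → W e h (n ∸ ℓ) (suc ℓ))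
        ≡⟨ ∑-cong (suc n) (λ ℓ _ → W-rec e h (n ∸ ℓ) ℓ) ⟩
      ∑ (suc n) (λ ℓ → W e′ (suc h) (n ∸ ℓ) ℓ + below (λ h′ → W e′ h′ (n ∸ ℓ) ℓ) h)
        ≡⟨ ∑-+ (suc n) (λ ℓ → W e′ (suc h) (n ∸ ℓ) ℓ) (λ ℓ → below (λ h′ → W e′ h′ (n ∸ ℓ) ℓ) h) ⟩
      S e′ (suc h) n + ∑ (suc n) (λ ℓ → below (λ h′ → W e′ h′ (n ∸ ℓ) ℓ) h)
        ≡⟨ cong (S e′ (suc h) n +_) (∑-below (suc n) (λ ℓ h′ → W e′ h′ (n ∸ ℓ) ℓ) h) ⟩
      S e′ (suc h) n + below (λ h′ → S e′ h′ n) h ∎)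
    where
    e′ : ℕ
    e′ = e + [ h ≡ᵇ k ]

  S-last : ∀ e h n → S e h (suc n) ≡ ∑ (suc n) (λ ℓ → W e h (suc n ∸ ℓ) ℓ) + W e h 0 (suc n)
  S-last e h n = trans (∑-snoc (suc n) (λ ℓ → W e h (suc n ∸ ℓ) ℓ))
                       (cong (λ a → ∑ (suc n) (λ ℓ → W e h (suc n ∸ ℓ) ℓ) + W e h a (suc n)) (n∸n≡0 n))

  S-pascal : ∀ e h n → S (suc e) h (suc n) ≡ S e h (suc n) + S (suc e) h n
  S-pascal e h n = begin
      S (suc e) h (suc n)
        ≡⟨ S-last (suc e) h n ⟩
      ∑ (suc n) (λ ℓ → W (suc e) h (suc n ∸ ℓ) ℓ) + W (suc e) h 0 (suc n)
        ≡⟨ cong₂ _+_ (∑-cong (suc n) pascal-term) (W-insert-none e h (suc n)) ⟩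
      ∑ (suc n) (λ ℓ → W e h (suc n ∸ ℓ) ℓ + W (suc e) h (n ∸ ℓ) ℓ) + W e h 0 (suc n)
        ≡⟨ cong (_+ W e h 0 (suc n)) (∑-+ (suc n) (λ ℓ → W e h (suc n ∸ ℓ) ℓ) (λ ℓ → W (suc e) h (n ∸ ℓ) ℓ)) ⟩
      (∑ (suc n) (λ ℓ → W e h (suc n ∸ ℓ) ℓ) + S (suc e) h n) + W e h 0 (suc n)
        ≡⟨ xy∙z≈xz∙y (∑ (suc n) (λ ℓ → W e h (suc n ∸ ℓ) ℓ)) (S (suc e) h n) (W e h 0 (suc n)) ⟩
      (∑ (suc n) (λ ℓ → W e h (suc n ∸ ℓ) ℓ) + W e h 0 (suc n)) + S (suc e) h n
        ≡⟨ cong (_+ S (suc e) h n) (sym (S-last e h n)) ⟩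
      S e h (suc n) + S (suc e) h n ∎
    where
    pascal-term : ∀ ℓ → ℓ < suc n → W (suc e) h (suc n ∸ ℓ) ℓ ≡ W e h (suc n ∸ ℓ) ℓ + W (suc e) h (n ∸ ℓ) ℓ
    pascal-term ℓ (s≤s ℓ≤n) rewrite +-∸-assoc 1 ℓ≤n = W-pascal e h (n ∸ ℓ) ℓ

  S-suc-sum : ∀ e h n → S (suc e) h n ≡ ∑ (suc n) (S e h)
  S-suc-sum e h zero = trans (cong (_+ 0) (W-insert-none e h 0)) (sym (+-identityʳ _))
  S-suc-sum e h (suc n) = begin
      S (suc e) h (suc n)                   ≡⟨ S-pascal e h n ⟩
      S e h (suc n) + S (suc e) h n         ≡⟨ cong (S e h (suc n) +_) (S-suc-sum e h n) ⟩
      S e h (suc n) + ∑ (suc n) (S e h)     ≡⟨ +-comm (S e h (suc n)) _ ⟩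
      ∑ (suc n) (S e h) + S e h (suc n)     ≡⟨ sym (∑-snoc (suc n) (S e h)) ⟩
      ∑ (suc (suc n)) (S e h)               ∎

  R : ℕ → ℕ → ℕ
  R = S 0

  R-base : ∀ h → R h 0 ≡ [ h ≡ᵇ 0 ]
  R-base h = begin
      W 0 h 0 0 + 0                               ≡⟨ +-identityʳ _ ⟩
      W 0 h 0 0                                   ≡⟨ W-empty 0 h 0 ⟩
      [ h ≡ᵇ 0 ] * binomShift 0 [ h ≡ᵇ k ]        ≡⟨ cong ([ h ≡ᵇ 0 ] *_) (multichoose-zero [ h ≡ᵇ k ]) ⟩
      [ h ≡ᵇ 0 ] * 1                              ≡⟨ *-identityʳ _ ⟩
      [ h ≡ᵇ 0 ]                                  ∎

  -- Off level k no horizontal step can be inserted at the first vertex.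
  R-rec-off : ∀ h n → (h ≡ᵇ k) ≡ false → R h (suc n) ≡ R (suc h) n + below (λ h′ → R h′ n) h
  R-rec-off h n off = begin
      R h (suc n)
        ≡⟨ S-step 0 h n ⟩
      W 0 h (suc n) 0 + (S [ h ≡ᵇ k ] (suc h) n + below (λ h′ → S [ h ≡ᵇ k ] h′ n) h)
        ≡⟨ cong₂ _+_ empty (cong (λ b → S [ b ] (suc h) n + below (λ h′ → S [ b ] h′ n) h) off) ⟩
      0 + (R (suc h) n + below (λ h′ → R h′ n) h) ∎
    where
    empty : W 0 h (suc n) 0 ≡ 0
    empty = trans (W-empty 0 h (suc n))
                  (trans (cong (λ b → [ h ≡ᵇ 0 ] * binomShift (suc n) [ b ]) off) (*-zeroʳ [ h ≡ᵇ 0 ]))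

  -- At level k, R h n = [h = 0] + Σ_{m < n} (R (h + 1) m + R (h - 1) m): the first
  -- vertex takes part in the insertion, which by S-suc-sum yields partial sums.
  R-on : ∀ h → (h ≡ᵇ k) ≡ true → ∀ n →
         R h n ≡ [ h ≡ᵇ 0 ] + ∑ n (λ m → R (suc h) m + below (λ h′ → R h′ m) h)
  R-on h on zero = trans (R-base h) (sym (+-identityʳ _))
  R-on h on (suc n) = begin
      R h (suc n)
        ≡⟨ S-step 0 h n ⟩
      W 0 h (suc n) 0 + (S [ h ≡ᵇ k ] (suc h) n + below (λ h′ → S [ h ≡ᵇ k ] h′ n) h)
        ≡⟨ cong₂ _+_ empty (cong (λ b → S [ b ] (suc h) n + below (λ h′ → S [ b ] h′ n) h) on) ⟩
      [ h ≡ᵇ 0 ] + (S 1 (suc h) n + below (λ h′ → S 1 h′ n) h)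
        ≡⟨ cong ([ h ≡ᵇ 0 ] +_) (cong₂ _+_ (S-suc-sum 0 (suc h) n) partial-below) ⟩
      [ h ≡ᵇ 0 ] + (∑ (suc n) (R (suc h)) + ∑ (suc n) (λ m → below (λ h′ → R h′ m) h))
        ≡⟨ cong ([ h ≡ᵇ 0 ] +_) (sym (∑-+ (suc n) (R (suc h)) (λ m → below (λ h′ → R h′ m) h))) ⟩
      [ h ≡ᵇ 0 ] + ∑ (suc n) (λ m → R (suc h) m + below (λ h′ → R h′ m) h) ∎
    where
    empty : W 0 h (suc n) 0 ≡ [ h ≡ᵇ 0 ]
    empty = begin
        W 0 h (suc n) 0                             ≡⟨ W-empty 0 h (suc n) ⟩
        [ h ≡ᵇ 0 ] * binomShift (suc n) [ h ≡ᵇ k ]  ≡⟨ cong (λ b → [ h ≡ᵇ 0 ] * binomShift (suc n) [ b ]) on ⟩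
        [ h ≡ᵇ 0 ] * binomShift (suc n) 1           ≡⟨ cong ([ h ≡ᵇ 0 ] *_) (multichoose-one (suc n)) ⟩
        [ h ≡ᵇ 0 ] * 1                              ≡⟨ *-identityʳ _ ⟩
        [ h ≡ᵇ 0 ]                                  ∎
    partial-below : below (λ h′ → S 1 h′ n) h ≡ ∑ (suc n) (λ m → below (λ h′ → R h′ m) h)
    partial-below = trans (below-cong (λ h′ → S-suc-sum 0 h′ n) h)
                          (sym (∑-below (suc n) (λ m h′ → R h′ m) h))

  R-rec-on : ∀ h n → (h ≡ᵇ k) ≡ true → R h (suc n) ≡ R (suc h) n + (R h n + below (λ h′ → R h′ n) h)
  R-rec-on h n on = begin
      R h (suc n)                           ≡⟨ R-on h on (suc n) ⟩
      [ h ≡ᵇ 0 ] + ∑ (suc n) step           ≡⟨ cong ([ h ≡ᵇ 0 ] +_) (∑-snoc n step) ⟩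
      [ h ≡ᵇ 0 ] + (∑ n step + step n)      ≡⟨ sym (+-assoc [ h ≡ᵇ 0 ] (∑ n step) (step n)) ⟩
      ([ h ≡ᵇ 0 ] + ∑ n step) + step n      ≡⟨ cong (_+ step n) (sym (R-on h on n)) ⟩
      R h n + (R (suc h) n + below (λ h′ → R h′ n) h)
                                            ≡⟨ x∙yz≈y∙xz (R h n) (R (suc h) n) _ ⟩
      R (suc h) n + (R h n + below (λ h′ → R h′ n) h) ∎
    where
    step : ℕ → ℕ
    step m = R (suc h) m + below (λ h′ → R h′ m) h

  R-rec : ∀ h n → R h (suc n) ≡ R (suc h) n + ((if h ≡ᵇ k then R h n else 0) + below (λ h′ → R h′ n) h)
  R-rec h n = by-level (h ≡ᵇ k) refl
    where
    by-level : ∀ b → (h ≡ᵇ k) ≡ b → R h (suc n) ≡ R (suc h) n + ((if b then R h n else 0) + below (λ h′ → R h′ n) h)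
    by-level false off = R-rec-off h n off
    by-level true on = R-rec-on h n on

  K≡R : ∀ n h → K h n ≡ R h n
  K≡R zero h = trans (K-base h) (sym (R-base h))
  K≡R (suc n) h = begin
      K h (suc n)
        ≡⟨ K-rec h n ⟩
      K (suc h) n + ((if h ≡ᵇ k then K h n else 0) + below (λ h′ → K h′ n) h)
        ≡⟨ cong₂ _+_ (K≡R n (suc h))
                     (cong₂ _+_ (cong (λ x → if h ≡ᵇ k then x else 0) (K≡R n h)) (below-cong (K≡R n) h)) ⟩
      R (suc h) n + ((if h ≡ᵇ k then R h n else 0) + below (λ h′ → R h′ n) h)
        ≡⟨ sym (R-rec h n) ⟩
      R h (suc n) ∎

  W-odd : ∀ e h a ℓ → parity (h + ℓ) ≡ 1ℙ → W e h a ℓ ≡ 0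
  W-odd e zero a zero ()
  W-odd e (suc h) a zero _ = W-empty e (suc h) a
  W-odd e h a (suc ℓ) odd =
    trans (W-rec e h a ℓ) (cong₂ _+_ (W-odd _ (suc h) a ℓ (trans (cong parity (sym (+-suc h ℓ))) odd)) (down h odd))
    where
    down : ∀ h → parity (h + suc ℓ) ≡ 1ℙ → below (λ h′ → W (e + [ h ≡ᵇ k ]) h′ a ℓ) h ≡ 0
    down zero _ = refl
    down (suc h) odd = W-odd _ h a ℓ (trans (cong (parity ∘ suc) (sym (+-suc h ℓ))) odd)

  W≡∑pDyck : ∀ N a ℓ → suc ℓ < N → W 0 0 a ℓ ≡ ∑ N (λ i → pDyck ℓ k i * binomShift a i)
  W≡∑pDyck N a ℓ ℓ<N = sym (∑-fibres N isDyck (verticesAt k) (binomShift a) (words ℓ) bounded)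
    where
    bounded : All (λ d → verticesAt k d < N) (words ℓ)
    bounded = All.map (λ {d} len≡ℓ → ≤-trans (s≤s (≤-trans (verticesAt-bound k d) (≤-reflexive (cong suc len≡ℓ)))) ℓ<N)
                      (words-length ℓ)

mainTheorem3 : (k n N : ℕ) → n + 2 ≤ N →
    motzkinK k n ≡
      sumTo (n / 2 + 1) (λ j →
        sumTo N (λ i → pDyck (2 * j) k i * binomShift (n ∸ 2 * j) i))
mainTheorem3 k n N n+2≤N = begin
    motzkinK k n
      ≡⟨ length-filterᵇ≡∑ₗ (isKMotzkin k) (words n) ⟩
    K 0 n
      ≡⟨ K≡R n 0 ⟩
    ∑ (suc n) (λ ℓ → W 0 0 (n ∸ ℓ) ℓ)
      ≡⟨ ∑-evens (λ ℓ → W 0 0 (n ∸ ℓ) ℓ) (λ m → W-odd 0 0 (n ∸ suc (2 * m)) (suc (2 * m)) (parity-odd m)) n ⟩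
    ∑ (suc (n / 2)) (λ j → W 0 0 (n ∸ 2 * j) (2 * j))
      ≡⟨ ∑-cong (suc (n / 2)) (λ j j≤n/2 → W≡∑pDyck N (n ∸ 2 * j) (2 * j) (length-bound j j≤n/2)) ⟩
    ∑ (suc (n / 2)) (λ j → ∑ N (λ i → pDyck (2 * j) k i * binomShift (n ∸ 2 * j) i))
      ≡⟨ sym (sumTo²≡∑ (n / 2) N (λ j i → pDyck (2 * j) k i * binomShift (n ∸ 2 * j) i)) ⟩
    sumTo (n / 2 + 1) (λ j → sumTo N (λ i → pDyck (2 * j) k i * binomShift (n ∸ 2 * j) i)) ∎
  where
  open Level k
  -- a Dyck path of length 2j ≤ n has at most n + 1 < N vertices
  length-bound : ∀ j → j < suc (n / 2) → suc (2 * j) < N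
  length-bound j (s≤s j≤n/2) = ≤-trans (+-monoʳ-≤ 2 2j≤n) (≤-trans (≤-reflexive (+-comm 2 n)) n+2≤N)
    where
    2j≤n : 2 * j ≤ n
    2j≤n = ≤-trans (*-monoʳ-≤ 2 j≤n/2) (≤-trans (≤-reflexive (*-comm 2 (n / 2))) (m/n*n≤m n 2))
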